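{- Let $p\ge3$ be prime, $G=E_p(p^3)=\langle a,b,c\mid a^p=b^p=c^p=1,[b,a]=c,[c,a]=1,[c,b]=1\rangle\simeq(C_p)^2\rtimes C_p$, $H=\langle a\rangle\simeq C_p$ and $H'_0=\langle a,c\rangle\simeq(C_p)^2$. Then $H^1(H,J_{G/H})=0$ and $H^1(H'_0,J_{G/H})=0$.
   Context: $[x,y]=x^{ -1}y^{ -1}xy$. $J_{G/H}$ is defined by the exact sequence of $G$-lattices $0\to\mathbb{Z}\to\mathbb{Z}[G/H]\to J_{G/H}\to0$, $1\mapsto\sum_{gH}gH$, with $\mathbb{Z}[G/H]$ the permutation lattice on left cosets. -}

module Defs where

open import Data.Nat using (ℕ; zero; suc; _+_; _*_; _∸_; NonZero; _%_)
open import Data.Nat.DivMod using (m%n<n)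
open import Data.Fin using (Fin; toℕ; fromℕ<)
open import Data.Integer as ℤ using (ℤ)
open import Data.Product using (Σ; _×_; _,_)
open import Relation.Binary.PropositionalEquality using (_≡_)

module _ (p : ℕ) .{{_ : NonZero p}} where

  ZMod : Set
  ZMod = Fin p

  red : ℕ → ZMod
  red n = fromℕ< (m%n<n n p)

  _⊕_ : ZMod → ZMod → ZMod
  i ⊕ j = red (toℕ i + toℕ j)

  _⊗_ : ZMod → ZMod → ZMod
  i ⊗ j = red (toℕ i * toℕ j)

  neg : ZMod → ZMod
  neg i = red (p ∸ toℕ i)

  -- The group G = E_p(p^3): the triple (i , j , k) stands for a^i b^j c^k.
  -- Using ba = abc (i.e. [b,a] = c) and c central:
  --   a^i b^j c^k · a^i' b^j' c^k' = a^(i+i') b^(j+j') c^(k+k'+j i').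
  G : Set
  G = ZMod × ZMod × ZMod

  e : G
  e = (red 0 , red 0 , red 0)

  mul : G → G → G
  mul (i , j , k) (i' , j' , k') = (i ⊕ i' , j ⊕ j' , (k ⊕ k') ⊕ (j ⊗ i'))

  inv : G → G
  inv (i , j , k) = (neg i , neg j , neg k ⊕ (j ⊗ i))

  pow : G → ℕ → G
  pow g zero = e
  pow g (suc n) = mul g (pow g n)

  gen-a gen-b gen-c : G
  gen-a = (red 1 , red 0 , red 0)
  gen-b = (red 0 , red 1 , red 0)
  gen-c = (red 0 , red 0 , red 1)

  InH : G → Set
  InH x = Σ ℕ λ t → x ≡ pow gen-a t

  InH'0 : G → Set
  InH'0 x = Σ ℕ λ t → Σ ℕ λ s → x ≡ mul (pow gen-a t) (pow gen-c s)

  -- Z[G/H] realised as functions f : G → ℤ constant on left cosets xH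
  -- (f ↔ Σ_{xH} f(x) xH); G acts by (g·f)(x) = f(g⁻¹x).
  IsPerm : (G → ℤ) → Set
  IsPerm f = ∀ x h → InH h → f (mul x h) ≡ f x

  act : G → (G → ℤ) → (G → ℤ)
  act g f x = f (mul (inv g) x)

  _+ᶠ_ _-ᶠ_ : (G → ℤ) → (G → ℤ) → (G → ℤ)
  (f +ᶠ f') x = f x ℤ.+ f' x
  (f -ᶠ f') x = f x ℤ.- f' x

  -- J_{G/H} = Z[G/H] / Z·(Σ xH); the norm element is the constant function 1,
  -- so two elements are equal in J iff they differ by a constant.
  _≈J_ : (G → ℤ) → (G → ℤ) → Set
  f ≈J f' = Σ ℤ λ n → ∀ x → f x ≡ f' x ℤ.+ n

  -- H^1(K, J_{G/H}) = 0: every crossed homomorphism K → J is principal.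
  -- (A map on K is given as a map on G of which only the values on K matter.)
  H1J-vanishes : (G → Set) → Set
  H1J-vanishes K =
    (φ : G → G → ℤ) →
    (∀ g → IsPerm (φ g)) →
    (∀ g h → K g → K h → φ (mul g h) ≈J (φ g +ᶠ act g (φ h))) →
    Σ (G → ℤ) λ m → IsPerm m × (∀ g → K g → φ g ≈J (act g m -ᶠ m))

{-# OPTIONS --safe #-}
module Submission where

-- For a cocycle ψ on a cyclic group ⟨g⟩ with gᵖ = e, ψ(gᵗ) is Σ_{i<t} gⁱ·ψ(g) up to a constant,
-- so the norm Σ_{i<p} gⁱ·ψ(g) is a constant function. If ψ(g) is constant on the g-orbit of some
-- point b, that constant is p·ψ(g)(b), and F = ψ(g) − ψ(g)(b) has norm exactly 0. Such an F is the
-- coboundary g·m − m of m = −⌊S/p⌋, S(x) = Σ_{t<p} Σ_{i<t} F(g⁻ⁱx): S drops by exactly p·F(x) from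
-- x to g⁻¹x, so the floor division is exact on differences.
-- For H = ⟨a⟩ the point b = e works, its coset being fixed by a. For H'₀ = ⟨a, c⟩, first subtract
-- the coboundary found on ⟨a⟩; since ac = ca and aᵖ = e, f = ψ(c) is then a-invariant. The point
-- b works for c because c⁻ⁱb = a⁻ʳ b aʳ, so the c-orbit of bH lies in the a-orbit of bH. The
-- resulting m₂ is again a-invariant, and m₁ + m₂ works on all of ⟨a, c⟩.

open import Algebra.Bundles using (Group)
open import Algebra.Core using (Op₁; Op₂)
open import Algebra.Structures using (IsGroup)
open import Data.Fin using (toℕ)
open import Data.Fin.Properties using (toℕ-injective; toℕ<n; toℕ-fromℕ<)
open import Data.Integer using (ℤ; +_; 0ℤ; 1ℤ; -_; _/ℕ_)
import Data.Integer.Properties as ℤₚ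
open import Data.Integer.DivMod using ([n/ℕd]*d≤n; n<s[n/ℕd]*d)
open import Algebra.Properties.CommutativeSemigroup ℤₚ.+-commutativeSemigroup
  using () renaming (interchange to +-interchange)
open import Algebra.Properties.Ring ℤₚ.+-*-ring
  using (+-identityʳ-unique; +-inverseˡ-unique; //-rightDividesˡ; //-rightDividesʳ)
open import Data.Nat using (ℕ; zero; suc; NonZero)
import Data.Nat.Properties as ℕₚ
open import Data.Nat.DivMod using (m%n<n; m<n⇒m%n≡m; [m+kn]%n≡m%n; %-distribˡ-+; %-distribˡ-*)
open import Data.Nat.GeneralisedArithmetic using (iterate)
open import Data.Nat.Primality using (Prime)
open import Data.Product using (Σ; _×_; _,_; proj₁; proj₂)
open import Level using (0ℓ)
open import Relation.Binary.Bundles using (Setoid)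
open import Relation.Binary.PropositionalEquality
  using (_≡_; refl; sym; trans; cong; cong₂; subst; isEquivalence; module ≡-Reasoning)
import Relation.Binary.Reasoning.Setoid as SetoidReasoning
open import Defs
  using (red; _⊕_; _⊗_; neg; G; e; mul; inv; pow; gen-a; gen-b; gen-c; InH; InH'0; H1J-vanishes)

module IntegerArithmetic where

  open Data.Integer using (_+_; _-_; _*_; _≤_; _<_) renaming (suc to sucℤ)
  open import Data.Integer.Tactic.RingSolver using (solve-∀)

  /ℕ-unique : ∀ n d .{{_ : NonZero d}} {k} → k * + d ≤ n → n < sucℤ k * + d → n /ℕ d ≡ k
  /ℕ-unique n d {k} kd≤n n<[1+k]d =
    ℤₚ.≤-antisym (below (n /ℕ d) k ([n/ℕd]*d≤n n d) n<[1+k]d) (below k (n /ℕ d) kd≤n (n<s[n/ℕd]*d n d))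
    where
    below : ∀ i j → i * + d ≤ n → n < sucℤ j * + d → i ≤ j
    below i j id≤n n<[1+j]d = subst (i ≤_) (ℤₚ.pred-suc j)
      (ℤₚ.i<j⇒i≤pred[j] (ℤₚ.*-cancelʳ-<-nonNeg {i} {sucℤ j} (+ d) (ℤₚ.≤-<-trans id≤n n<[1+j]d)))

  [k*d+n]/ℕd≡k+n/ℕd : ∀ k n d .{{_ : NonZero d}} → (k * + d + n) /ℕ d ≡ k + n /ℕ d
  [k*d+n]/ℕd≡k+n/ℕd k n d = /ℕ-unique (k * + d + n) d lower upper
    where
    q = n /ℕ d
    lower : (k + q) * + d ≤ k * + d + n
    lower = subst (_≤ k * + d + n) (sym (ℤₚ.*-distribʳ-+ (+ d) k q))
              (ℤₚ.+-monoʳ-≤ (k * + d) ([n/ℕd]*d≤n n d))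
    split : ∀ k q d → (1ℤ + (k + q)) * d ≡ k * d + (1ℤ + q) * d
    split = solve-∀
    upper : k * + d + n < sucℤ (k + q) * + d
    upper = subst (k * + d + n <_) (sym (split k q (+ d)))
              (ℤₚ.+-monoʳ-< (k * + d) (n<s[n/ℕd]*d n d))

  [m-n]+n≡m : ∀ m n → m - n + n ≡ m
  [m-n]+n≡m m n = //-rightDividesˡ n m

  [m+n]-n≡m : ∀ m n → m + n - n ≡ m
  [m+n]-n≡m m n = //-rightDividesʳ n m

  +-minus-interchange : ∀ a b c d → (a + b) - (c + d) ≡ (a - c) + (b - d)
  +-minus-interchange a b c d =
    trans (cong (_+_ (a + b)) (ℤₚ.neg-distrib-+ c d)) (+-interchange a b (- c) (- d))

open IntegerArithmetic

module Orbit {X : Set} (σ : X → X) where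

  open Data.Integer using (_+_; _-_; _*_)
  open import Data.Integer.Tactic.RingSolver using (solve-∀)

  orbitSum : ℕ → (X → ℤ) → X → ℤ
  orbitSum zero    F x = 0ℤ
  orbitSum (suc n) F x = F x + orbitSum n F (σ x)

  orbitSum-natural : ∀ {τ : X → X} {F} → (∀ x → σ (τ x) ≡ τ (σ x)) → (∀ x → F (τ x) ≡ F x) →
                     ∀ n x → orbitSum n F (τ x) ≡ orbitSum n F x
  orbitSum-natural στ≡τσ Fτ≡F zero    x = refl
  orbitSum-natural στ≡τσ Fτ≡F (suc n) x = cong₂ _+_ (Fτ≡F x)
    (trans (cong (orbitSum n _) (στ≡τσ x)) (orbitSum-natural στ≡τσ Fτ≡F n (σ x)))

  orbitSum-coboundary : ∀ {F} (m : X → ℤ) → (∀ x → F x ≡ m (σ x) - m x) →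
                        ∀ n x → orbitSum n F x ≡ m (iterate σ x n) - m x
  orbitSum-coboundary m F≡δm zero    x = sym (ℤₚ.+-inverseʳ (m x))
  orbitSum-coboundary {F} m F≡δm (suc n) x = begin
    F x + orbitSum n F (σ x)            ≡⟨ cong₂ _+_ (F≡δm x) (orbitSum-coboundary m F≡δm n (σ x)) ⟩
    (m (σ x) - m x) + (m y - m (σ x))   ≡⟨ ℤₚ.+-comm (m (σ x) - m x) (m y - m (σ x)) ⟩
    (m y - m (σ x)) + (m (σ x) - m x)   ≡⟨ ℤₚ.+-minus-telescope (m y) (m (σ x)) (m x) ⟩
    m y - m x                           ∎
    where
    open ≡-Reasoning
    y = iterate σ (σ x) n

  orbitSum-constant : ∀ {F x} → (∀ i → F (iterate σ x i) ≡ F x) → ∀ n → orbitSum n F x ≡ + n * F x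
  orbitSum-constant {F} {x} const zero    = sym (ℤₚ.*-zeroˡ (F x))
  orbitSum-constant {F} {x} const (suc n) = begin
    F x + orbitSum n F (σ x)   ≡⟨ cong (_+_ (F x)) (orbitSum-constant const′ n) ⟩
    F x + + n * F (σ x)        ≡⟨ cong (λ y → F x + + n * y) (const 1) ⟩
    F x + + n * F x            ≡⟨ ℤₚ.suc-* (+ n) (F x) ⟨
    + suc n * F x              ∎
    where
    open ≡-Reasoning
    const′ : ∀ i → F (iterate σ (σ x) i) ≡ F (σ x)
    const′ i = trans (const (suc i)) (sym (const 1))

  orbitSum-shift : ∀ F k n x → orbitSum n (λ y → F y - k) x ≡ orbitSum n F x - + n * k
  orbitSum-shift F k zero    x = cong -_ (sym (ℤₚ.*-zeroˡ k))
  orbitSum-shift F k (suc n) x = begin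
    (F x - k) + orbitSum n (λ y → F y - k) (σ x)   ≡⟨ cong (_+_ (F x - k)) (orbitSum-shift F k n (σ x)) ⟩
    (F x - k) + (O - + n * k)                      ≡⟨ +-minus-interchange (F x) O k (+ n * k) ⟨
    (F x + O) - (k + + n * k)                      ≡⟨ cong (λ y → F x + O - y) (ℤₚ.suc-* (+ n) k) ⟨
    (F x + O) - + suc n * k                        ∎
    where
    open ≡-Reasoning
    O = orbitSum n F (σ x)

  iterate-drift : ∀ (F : X → ℤ) {k} → (∀ x → F (σ x) ≡ F x + k) →
                  ∀ n x → F (iterate σ x n) ≡ F x + + n * k
  iterate-drift F {k} drift zero    x =
    sym (trans (cong (_+_ (F x)) (ℤₚ.*-zeroˡ k)) (ℤₚ.+-identityʳ (F x)))
  iterate-drift F {k} drift (suc n) x = begin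
    F (iterate σ (σ x) n)   ≡⟨ iterate-drift F drift n (σ x) ⟩
    F (σ x) + + n * k       ≡⟨ cong (_+ + n * k) (drift x) ⟩
    F x + k + + n * k       ≡⟨ ℤₚ.+-assoc (F x) k (+ n * k) ⟩
    F x + (k + + n * k)     ≡⟨ cong (_+_ (F x)) (ℤₚ.suc-* (+ n) k) ⟨
    F x + + suc n * k       ∎
    where open ≡-Reasoning

  drift≡0 : ∀ p .{{_ : NonZero p}} (F : X → ℤ) {k} → (∀ x → F (σ x) ≡ F x + k) →
            ∀ x → iterate σ x p ≡ x → k ≡ 0ℤ
  drift≡0 p F {k} drift x periodic = ℤₚ.*-cancelˡ-≡ (+ p) k 0ℤ (trans pk≡0 (sym (ℤₚ.*-zeroʳ (+ p))))
    where
    pk≡0 : + p * k ≡ 0ℤ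
    pk≡0 = +-identityʳ-unique (F x) (+ p * k)
      (sym (trans (sym (cong F periodic)) (iterate-drift F drift p x)))

  orbitSum² : ℕ → (X → ℤ) → X → ℤ
  orbitSum² zero    F x = 0ℤ
  orbitSum² (suc n) F x = orbitSum² n F x + orbitSum n F x

  orbitSum²-suc : ∀ F n x → orbitSum² (suc n) F x ≡ F x * + n + orbitSum² n F (σ x)
  orbitSum²-suc F zero    x = cong (_+ 0ℤ) (sym (ℤₚ.*-zeroʳ (F x)))
  orbitSum²-suc F (suc n) x = begin
    orbitSum² (suc n) F x + orbitSum (suc n) F x
      ≡⟨ cong (_+ orbitSum (suc n) F x) (orbitSum²-suc F n x) ⟩
    (F x * + n + orbitSum² n F (σ x)) + (F x + orbitSum n F (σ x))
      ≡⟨ regroup (F x) (F x * + n) (orbitSum² n F (σ x)) (orbitSum n F (σ x)) ⟩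
    (F x + F x * + n) + orbitSum² (suc n) F (σ x)
      ≡⟨ cong (_+ orbitSum² (suc n) F (σ x)) (ℤₚ.*-suc (F x) (+ n)) ⟨
    F x * + suc n + orbitSum² (suc n) F (σ x) ∎
    where
    open ≡-Reasoning
    regroup : ∀ a b c d → (b + c) + (a + d) ≡ (a + b) + (c + d)
    regroup = solve-∀

  module _ (p : ℕ) .{{_ : NonZero p}} (F : X → ℤ) where

    potential : X → ℤ
    potential x = - (orbitSum² p F x /ℕ p)

    potential-coboundary : (∀ x → orbitSum p F x ≡ 0ℤ) → ∀ x → F x ≡ potential (σ x) - potential x
    potential-coboundary norm≡0 x = begin
      F x                                                 ≡⟨ cancel (F x) (S (σ x) /ℕ p) ⟩
      - (S (σ x) /ℕ p) - - (F x + S (σ x) /ℕ p)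
        ≡⟨ cong (λ y → - (S (σ x) /ℕ p) - - y) ([k*d+n]/ℕd≡k+n/ℕd (F x) (S (σ x)) p) ⟨
      - (S (σ x) /ℕ p) - - ((F x * + p + S (σ x)) /ℕ p)
        ≡⟨ cong (λ y → - (S (σ x) /ℕ p) - - (y /ℕ p)) S-step ⟨
      potential (σ x) - potential x                       ∎
      where
      open ≡-Reasoning
      S : X → ℤ
      S = orbitSum² p F
      cancel : ∀ a b → a ≡ - b - - (a + b)
      cancel = solve-∀
      S-step : S x ≡ F x * + p + S (σ x)
      S-step = begin
        S x                     ≡⟨ ℤₚ.+-identityʳ (S x) ⟨
        S x + 0ℤ                ≡⟨ cong (_+_ (S x)) (norm≡0 x) ⟨
        orbitSum² (suc p) F x   ≡⟨ orbitSum²-suc F p x ⟩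
        F x * + p + S (σ x)     ∎

    potential-natural : ∀ {τ : X → X} → (∀ x → σ (τ x) ≡ τ (σ x)) → (∀ x → F (τ x) ≡ F x) →
                        ∀ x → potential (τ x) ≡ potential x
    potential-natural {τ} στ≡τσ Fτ≡F x = cong (λ s → - (s /ℕ p)) (orbitSum²-natural p x)
      where
      orbitSum²-natural : ∀ n x → orbitSum² n F (τ x) ≡ orbitSum² n F x
      orbitSum²-natural zero    x = refl
      orbitSum²-natural (suc n) x =
        cong₂ _+_ (orbitSum²-natural n x) (orbitSum-natural στ≡τσ Fτ≡F n x)

module Cohomology
  {Γ : Set} {_∙_ : Op₂ Γ} {ε : Γ} {_⁻¹ : Op₁ Γ} (isGroup : IsGroup _≡_ _∙_ ε _⁻¹)
  (InH : Γ → Set)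
  where

  open IsGroup isGroup using (assoc; identityˡ; identityʳ; inverseˡ)
  open Data.Integer using (_+_; _-_; _*_)

  group : Group 0ℓ 0ℓ
  group = record { isGroup = isGroup }

  open import Algebra.Properties.Group group using (⁻¹-anti-homo-∙; ε⁻¹≈ε)

  _^_ : Γ → ℕ → Γ
  g ^ zero  = ε
  g ^ suc n = g ∙ (g ^ n)

  ⟨_⟩ : Γ → Γ → Set
  ⟨ g ⟩ x = Σ ℕ λ t → x ≡ g ^ t

  ⟨_⟩⟨_⟩ : Γ → Γ → Γ → Set
  ⟨ g ⟩⟨ h ⟩ x = Σ ℕ λ t → Σ ℕ λ s → x ≡ (g ^ t) ∙ (h ^ s)

  [g∙h]⁻¹∙x≡h⁻¹∙[g⁻¹∙x] : ∀ g h x → ((g ∙ h) ⁻¹) ∙ x ≡ (h ⁻¹) ∙ ((g ⁻¹) ∙ x)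
  [g∙h]⁻¹∙x≡h⁻¹∙[g⁻¹∙x] g h x = trans (cong (_∙ x) (⁻¹-anti-homo-∙ g h)) (assoc (h ⁻¹) (g ⁻¹) x)

  ε⁻¹∙x≡x : ∀ x → (ε ⁻¹) ∙ x ≡ x
  ε⁻¹∙x≡x x = trans (cong (_∙ x) ε⁻¹≈ε) (identityˡ x)

  iterate[g⁻¹∙]≡[gⁿ]⁻¹∙ : ∀ g x n → iterate ((g ⁻¹) ∙_) x n ≡ ((g ^ n) ⁻¹) ∙ x
  iterate[g⁻¹∙]≡[gⁿ]⁻¹∙ g x zero    = sym (ε⁻¹∙x≡x x)
  iterate[g⁻¹∙]≡[gⁿ]⁻¹∙ g x (suc n) =
    trans (iterate[g⁻¹∙]≡[gⁿ]⁻¹∙ g ((g ⁻¹) ∙ x) n) (sym ([g∙h]⁻¹∙x≡h⁻¹∙[g⁻¹∙x] g (g ^ n) x))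

  Fn : Set
  Fn = Γ → ℤ

  infixl 6 _+ᶠ_ _-ᶠ_
  infix 4 _≈J_ _≈Jˢ_

  _+ᶠ_ _-ᶠ_ : Fn → Fn → Fn
  (f +ᶠ f′) x = f x + f′ x
  (f -ᶠ f′) x = f x - f′ x

  0ᶠ : Fn
  0ᶠ _ = 0ℤ

  act : Γ → Fn → Fn
  act g f x = f ((g ⁻¹) ∙ x)

  -- Defs states equality in J as the Σ-type _≈Jˢ_, from which Agda cannot infer the functions
  -- being compared; the development works with this record and converts only in H¹-vanishes.
  record _≈J_ (f f′ : Fn) : Set where
    constructor mk≈J
    field
      offset   : ℤ
      ≡+offset : ∀ x → f x ≡ f′ x + offset

  _≈Jˢ_ : Fn → Fn → Set
  f ≈Jˢ f′ = Σ ℤ λ n → ∀ x → f x ≡ f′ x + n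

  IsPerm : Fn → Set
  IsPerm f = ∀ x h → InH h → f (x ∙ h) ≡ f x

  δ : Fn → Γ → Fn
  δ m g = act g m -ᶠ m

  IsCocycleOn : (Γ → Set) → (Γ → Fn) → Set
  IsCocycleOn K φ = ∀ g h → K g → K h → φ (g ∙ h) ≈J φ g +ᶠ act g (φ h)

  H¹-vanishes : (Γ → Set) → Set
  H¹-vanishes K =
    (φ : Γ → Fn) → (∀ g → IsPerm (φ g)) →
    (∀ g h → K g → K h → φ (g ∙ h) ≈Jˢ φ g +ᶠ act g (φ h)) →
    Σ Fn λ m → IsPerm m × (∀ g → K g → φ g ≈Jˢ δ m g)

  ≈Jˢ⇒≈J : ∀ {f f′} → f ≈Jˢ f′ → f ≈J f′
  ≈Jˢ⇒≈J (n , eq) = mk≈J n eq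

  ≈J⇒≈Jˢ : ∀ {f f′} → f ≈J f′ → f ≈Jˢ f′
  ≈J⇒≈Jˢ (mk≈J n eq) = n , eq

  cocycleˢ⇒cocycle : ∀ {K φ} → (∀ g h → K g → K h → φ (g ∙ h) ≈Jˢ φ g +ᶠ act g (φ h)) → IsCocycleOn K φ
  cocycleˢ⇒cocycle φ-cocycle g h g∈K h∈K = ≈Jˢ⇒≈J (φ-cocycle g h g∈K h∈K)

  ≈J-refl : ∀ {f} → f ≈J f
  ≈J-refl = mk≈J 0ℤ λ x → sym (ℤₚ.+-identityʳ _)

  ≈J-sym : ∀ {f f′} → f ≈J f′ → f′ ≈J f
  ≈J-sym {f} {f′} (mk≈J n eq) =
    mk≈J (- n) λ x → trans (sym ([m+n]-n≡m (f′ x) n)) (cong (_- n) (sym (eq x)))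

  ≈J-trans : ∀ {f g h} → f ≈J g → g ≈J h → f ≈J h
  ≈J-trans {h = h} (mk≈J n eq) (mk≈J n′ eq′) =
    mk≈J (n′ + n) λ x → trans (eq x) (trans (cong (_+ n) (eq′ x)) (ℤₚ.+-assoc (h x) n′ n))

  J : Setoid 0ℓ 0ℓ
  J = record
    { _≈_ = _≈J_
    ; isEquivalence = record { refl = ≈J-refl ; sym = ≈J-sym ; trans = ≈J-trans }
    }

  ≗⇒≈J : ∀ {f f′} → (∀ x → f x ≡ f′ x) → f ≈J f′
  ≗⇒≈J eq = mk≈J 0ℤ λ x → trans (eq x) (sym (ℤₚ.+-identityʳ _))

  +ᶠ-cong : ∀ {f f′ g g′} → f ≈J f′ → g ≈J g′ → f +ᶠ g ≈J f′ +ᶠ g′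
  +ᶠ-cong {f′ = f′} {g′ = g′} (mk≈J n eq) (mk≈J n′ eq′) =
    mk≈J (n + n′) λ x → trans (cong₂ _+_ (eq x) (eq′ x)) (+-interchange (f′ x) n (g′ x) n′)

  -ᶠ-cong : ∀ {f f′ g g′} → f ≈J f′ → g ≈J g′ → f -ᶠ g ≈J f′ -ᶠ g′
  -ᶠ-cong {f′ = f′} {g′ = g′} (mk≈J n eq) (mk≈J n′ eq′) =
    mk≈J (n - n′) λ x → trans (cong₂ _-_ (eq x) (eq′ x)) (+-minus-interchange (f′ x) n (g′ x) n′)

  act-cong : ∀ g {f f′} → f ≈J f′ → act g f ≈J act g f′
  act-cong g (mk≈J n eq) = mk≈J n λ x → eq ((g ⁻¹) ∙ x)

  ≈J-0ᶠ⇒constant : ∀ {f} → f ≈J 0ᶠ → ∀ x y → f x ≡ f y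
  ≈J-0ᶠ⇒constant (mk≈J n eq) x y = trans (eq x) (sym (eq y))

  -ᶠ-perm : ∀ {f f′} → IsPerm f → IsPerm f′ → IsPerm (f -ᶠ f′)
  -ᶠ-perm f-perm f′-perm x h h∈H = cong₂ _-_ (f-perm x h h∈H) (f′-perm x h h∈H)

  act-perm : ∀ {f} g → IsPerm f → IsPerm (act g f)
  act-perm {f} g f-perm x h h∈H = trans (cong f (sym (assoc (g ⁻¹) x h))) (f-perm ((g ⁻¹) ∙ x) h h∈H)

  δ-perm : ∀ {m} g → IsPerm m → IsPerm (δ m g)
  δ-perm g m-perm = -ᶠ-perm (act-perm g m-perm) m-perm

  δ-cocycle : ∀ m g h x → δ m (g ∙ h) x ≡ (δ m g +ᶠ act g (δ m h)) x
  δ-cocycle m g h x = begin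
    m (((g ∙ h) ⁻¹) ∙ x) - m x       ≡⟨ cong (λ y → m y - m x) ([g∙h]⁻¹∙x≡h⁻¹∙[g⁻¹∙x] g h x) ⟩
    m z - m x                        ≡⟨ ℤₚ.+-minus-telescope (m z) (m y) (m x) ⟨
    (m z - m y) + (m y - m x)        ≡⟨ ℤₚ.+-comm (m z - m y) (m y - m x) ⟩
    (m y - m x) + (m z - m y)        ∎
    where
    open ≡-Reasoning
    y = (g ⁻¹) ∙ x
    z = (h ⁻¹) ∙ y

  δ-+ᶠ : ∀ m m′ g x → δ (m +ᶠ m′) g x ≡ (δ m g +ᶠ δ m′ g) x
  δ-+ᶠ m m′ g x = +-minus-interchange (m ((g ⁻¹) ∙ x)) (m′ ((g ⁻¹) ∙ x)) (m x) (m′ x)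

  δ-fixed : ∀ {m} g → (∀ x → m ((g ⁻¹) ∙ x) ≡ m x) → ∀ x → δ m g x ≡ 0ℤ
  δ-fixed {m} g fixed x = trans (cong (_- m x) (fixed x)) (ℤₚ.+-inverseʳ (m x))

  fixed-^ : ∀ {f : Fn} g → (∀ x → f ((g ⁻¹) ∙ x) ≡ f x) → ∀ n x → f (((g ^ n) ⁻¹) ∙ x) ≡ f x
  fixed-^ {f} g fixed zero    x = cong f (ε⁻¹∙x≡x x)
  fixed-^ {f} g fixed (suc n) x =
    trans (cong f ([g∙h]⁻¹∙x≡h⁻¹∙[g⁻¹∙x] g (g ^ n) x))
          (trans (fixed-^ g fixed n ((g ⁻¹) ∙ x)) (fixed x))

  cocycle-ε : ∀ {K φ} → K ε → IsCocycleOn K φ → φ ε ≈J 0ᶠ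
  cocycle-ε {φ = φ} ε∈K φ-cocycle = mk≈J (- n) λ x → trans (φεx≡-n x) (sym (ℤₚ.+-identityˡ (- n)))
    where
    open _≈J_ (φ-cocycle ε ε ε∈K ε∈K) renaming (offset to n)
    φεx≡-n : ∀ x → φ ε x ≡ - n
    φεx≡-n x = +-inverseˡ-unique (φ ε x) n (+-identityʳ-unique (φ ε x) (φ ε x + n) (sym (begin
      φ ε x                          ≡⟨ cong (λ g → φ g x) (identityˡ ε) ⟨
      φ (ε ∙ ε) x                    ≡⟨ ≡+offset x ⟩
      φ ε x + φ ε ((ε ⁻¹) ∙ x) + n   ≡⟨ cong (λ y → φ ε x + φ ε y + n) (ε⁻¹∙x≡x x) ⟩
      φ ε x + φ ε x + n              ≡⟨ ℤₚ.+-assoc (φ ε x) (φ ε x) n ⟩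
      φ ε x + (φ ε x + n)            ∎)))
      where open ≡-Reasoning

  cocycle-mono : ∀ {K K′ φ} → (∀ g → K g → K′ g) → IsCocycleOn K′ φ → IsCocycleOn K φ
  cocycle-mono K⊆K′ φ-cocycle g h g∈K h∈K = φ-cocycle g h (K⊆K′ g g∈K) (K⊆K′ h h∈K)

  cocycle-sub-δ : ∀ {K φ} m → IsCocycleOn K φ → IsCocycleOn K (λ g → φ g -ᶠ δ m g)
  cocycle-sub-δ {φ = φ} m φ-cocycle g h g∈K h∈K = begin
    φ (g ∙ h) -ᶠ δ m (g ∙ h)
      ≈⟨ -ᶠ-cong (φ-cocycle g h g∈K h∈K) (≗⇒≈J (δ-cocycle m g h)) ⟩
    (φ g +ᶠ act g (φ h)) -ᶠ (δ m g +ᶠ act g (δ m h))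
      ≈⟨ ≗⇒≈J (λ x → +-minus-interchange (φ g x) (act g (φ h) x) (δ m g x) (act g (δ m h) x)) ⟩
    (φ g -ᶠ δ m g) +ᶠ act g (φ h -ᶠ δ m h) ∎
    where open SetoidReasoning J

  cocycle-^ : ∀ {g ψ} → IsCocycleOn ⟨ g ⟩ ψ → ∀ t → ψ (g ^ t) ≈J Orbit.orbitSum ((g ⁻¹) ∙_) t (ψ g)
  cocycle-^ ψ-cocycle zero    = cocycle-ε (0 , refl) ψ-cocycle
  cocycle-^ {g} {ψ} ψ-cocycle (suc t) = begin
    ψ (g ∙ (g ^ t))                  ≈⟨ ψ-cocycle g (g ^ t) (1 , sym (identityʳ g)) (t , refl) ⟩
    ψ g +ᶠ act g (ψ (g ^ t))         ≈⟨ +ᶠ-cong (≈J-refl {ψ g}) (act-cong g (cocycle-^ ψ-cocycle t)) ⟩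
    orbitSum (suc t) (ψ g)           ∎
    where
    open SetoidReasoning J
    open Orbit ((g ⁻¹) ∙_)

  J-fixed⇒fixed : ∀ p .{{_ : NonZero p}} {g f} → g ^ p ≡ ε → act g f ≈J f → ∀ x → f ((g ⁻¹) ∙ x) ≡ f x
  J-fixed⇒fixed p {g} {f} gᵖ≡ε (mk≈J k eq) x = begin
    f ((g ⁻¹) ∙ x) ≡⟨ eq x ⟩
    f x + k        ≡⟨ cong (_+_ (f x)) (drift≡0 p f eq x periodic) ⟩
    f x + 0ℤ       ≡⟨ ℤₚ.+-identityʳ (f x) ⟩
    f x            ∎
    where
    open ≡-Reasoning
    open Orbit ((g ⁻¹) ∙_)
    periodic : iterate ((g ⁻¹) ∙_) x p ≡ x
    periodic = trans (iterate[g⁻¹∙]≡[gⁿ]⁻¹∙ g x p) (trans (cong (λ h → (h ⁻¹) ∙ x) gᵖ≡ε) (ε⁻¹∙x≡x x))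

  H¹-vanishes-resp : ∀ {K K′} → (∀ g → K′ g → K g) → (∀ g → K g → K′ g) → H¹-vanishes K → H¹-vanishes K′
  H¹-vanishes-resp K′⊆K K⊆K′ vanishes φ φ-perm φ-cocycle =
    let (m , m-perm , φ≈δm) = vanishes φ φ-perm λ g h g∈K h∈K → φ-cocycle g h (K⊆K′ g g∈K) (K⊆K′ h h∈K)
    in m , m-perm , λ g g∈K′ → φ≈δm g (K′⊆K g g∈K′)

  module CoboundaryOnCyclic (p : ℕ) .{{_ : NonZero p}} {g : Γ} (gᵖ≡ε : g ^ p ≡ ε)
                (ψ : Γ → Fn) (ψ-cocycle : IsCocycleOn ⟨ g ⟩ ψ)
                (b : Γ) (constant-on-orbit : ∀ i → ψ g (((g ^ i) ⁻¹) ∙ b) ≡ ψ g b) where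

    open Orbit ((g ⁻¹) ∙_)

    F : Fn
    F x = ψ g x - ψ g b

    norm-ψg-constant : ∀ x → orbitSum p (ψ g) x ≡ orbitSum p (ψ g) b
    norm-ψg-constant x = ≈J-0ᶠ⇒constant (begin
      orbitSum p (ψ g)  ≈⟨ cocycle-^ ψ-cocycle p ⟨
      ψ (g ^ p)         ≡⟨ cong ψ gᵖ≡ε ⟩
      ψ ε               ≈⟨ cocycle-ε (0 , refl) ψ-cocycle ⟩
      0ᶠ                ∎) x b
      where open SetoidReasoning J

    norm-F≡0 : ∀ x → orbitSum p F x ≡ 0ℤ
    norm-F≡0 x = begin
      orbitSum p F x                     ≡⟨ orbitSum-shift (ψ g) (ψ g b) p x ⟩
      orbitSum p (ψ g) x - + p * ψ g b   ≡⟨ cong (_- + p * ψ g b) (norm-ψg-constant x) ⟩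
      orbitSum p (ψ g) b - + p * ψ g b   ≡⟨ cong (_- + p * ψ g b) (orbitSum-constant orbit-b p) ⟩
      + p * ψ g b - + p * ψ g b          ≡⟨ ℤₚ.+-inverseʳ (+ p * ψ g b) ⟩
      0ℤ                                 ∎
      where
      open ≡-Reasoning
      orbit-b : ∀ i → ψ g (iterate ((g ⁻¹) ∙_) b i) ≡ ψ g b
      orbit-b i = trans (cong (ψ g) (iterate[g⁻¹∙]≡[gⁿ]⁻¹∙ g b i)) (constant-on-orbit i)

    m : Fn
    m = potential p F

    ψ≈δm : ∀ t → ψ (g ^ t) ≈J δ m (g ^ t)
    ψ≈δm t = begin
      ψ (g ^ t)          ≈⟨ cocycle-^ ψ-cocycle t ⟩
      orbitSum t (ψ g)   ≈⟨ mk≈J (+ t * ψ g b) orbitSum-ψg≡orbitSum-F+tψgb ⟩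
      orbitSum t F       ≈⟨ ≗⇒≈J orbitSum-F≡δm ⟩
      δ m (g ^ t)        ∎
      where
      open SetoidReasoning J
      orbitSum-ψg≡orbitSum-F+tψgb : ∀ x → orbitSum t (ψ g) x ≡ orbitSum t F x + + t * ψ g b
      orbitSum-ψg≡orbitSum-F+tψgb x = trans (sym ([m-n]+n≡m (orbitSum t (ψ g) x) (+ t * ψ g b)))
        (cong (_+ + t * ψ g b) (sym (orbitSum-shift (ψ g) (ψ g b) t x)))
      orbitSum-F≡δm : ∀ x → orbitSum t F x ≡ δ m (g ^ t) x
      orbitSum-F≡δm x = trans (orbitSum-coboundary m (potential-coboundary p F norm-F≡0) t x)
                              (cong (λ y → m y - m x) (iterate[g⁻¹∙]≡[gⁿ]⁻¹∙ g x t))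

    m-natural : ∀ {τ : Γ → Γ} → (∀ x → (g ⁻¹) ∙ τ x ≡ τ ((g ⁻¹) ∙ x)) →
                (∀ x → ψ g (τ x) ≡ ψ g x) → ∀ x → m (τ x) ≡ m x
    m-natural στ≡τσ ψgτ≡ψg = potential-natural p F στ≡τσ (λ x → cong (_- ψ g b) (ψgτ≡ψg x))

  module _ (p : ℕ) .{{_ : NonZero p}} {a : Γ} (aᵖ≡ε : a ^ p ≡ ε) (⟨a⟩⊆H : ∀ t → InH (a ^ t)) where

    module VanishingOnCyclic
      (φ : Γ → Fn) (φ-perm : ∀ g → IsPerm (φ g)) (φ-cocycle : IsCocycleOn ⟨ a ⟩ φ) where

      constant-on-orbit : ∀ i → φ a (((a ^ i) ⁻¹) ∙ ε) ≡ φ a ε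
      constant-on-orbit i = begin
        φ a (((a ^ i) ⁻¹) ∙ ε)        ≡⟨ cong (φ a) (identityʳ ((a ^ i) ⁻¹)) ⟩
        φ a ((a ^ i) ⁻¹)              ≡⟨ φ-perm a ((a ^ i) ⁻¹) (a ^ i) (⟨a⟩⊆H i) ⟨
        φ a (((a ^ i) ⁻¹) ∙ (a ^ i))  ≡⟨ cong (φ a) (inverseˡ (a ^ i)) ⟩
        φ a ε                         ∎
        where open ≡-Reasoning

      open CoboundaryOnCyclic p aᵖ≡ε φ φ-cocycle ε constant-on-orbit public using (m; ψ≈δm; m-natural)

      m-perm : IsPerm m
      m-perm x h h∈H = m-natural (λ y → sym (assoc (a ⁻¹) y h)) (λ y → φ-perm a y h h∈H) x

    H¹-vanishes-cyclic : H¹-vanishes ⟨ a ⟩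
    H¹-vanishes-cyclic φ φ-perm φ-cocycle = m , m-perm , λ { _ (t , refl) → ≈J⇒≈Jˢ (ψ≈δm t) }
      where open VanishingOnCyclic φ φ-perm (cocycleˢ⇒cocycle {φ = φ} φ-cocycle)

  module _ (p : ℕ) .{{_ : NonZero p}} {a b c : Γ} (aᵖ≡ε : a ^ p ≡ ε) (cᵖ≡ε : c ^ p ≡ ε)
           (⟨a⟩⊆H : ∀ t → InH (a ^ t)) (ac≡ca : a ∙ c ≡ c ∙ a)
           (c-orbit : ∀ i → Σ ℕ λ r → ((c ^ i) ⁻¹) ∙ b ≡ ((a ^ r) ⁻¹) ∙ (b ∙ (a ^ r))) where

    module VanishingOnBicyclic
      (φ : Γ → Fn) (φ-perm : ∀ g → IsPerm (φ g)) (φ-cocycle : IsCocycleOn ⟨ a ⟩⟨ c ⟩ φ) where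

      ⟨a⟩⊆⟨a⟩⟨c⟩ : ∀ g → ⟨ a ⟩ g → ⟨ a ⟩⟨ c ⟩ g
      ⟨a⟩⊆⟨a⟩⟨c⟩ _ (t , refl) = t , 0 , sym (identityʳ (a ^ t))

      ⟨c⟩⊆⟨a⟩⟨c⟩ : ∀ g → ⟨ c ⟩ g → ⟨ a ⟩⟨ c ⟩ g
      ⟨c⟩⊆⟨a⟩⟨c⟩ _ (s , refl) = 0 , s , sym (identityˡ (c ^ s))

      open VanishingOnCyclic p aᵖ≡ε ⟨a⟩⊆H φ φ-perm (cocycle-mono {φ = φ} ⟨a⟩⊆⟨a⟩⟨c⟩ φ-cocycle)
        using () renaming (m to m₁; m-perm to m₁-perm; ψ≈δm to φ≈δm₁)

      ψ : Γ → Fn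
      ψ g = φ g -ᶠ δ m₁ g

      ψ-cocycle : IsCocycleOn ⟨ a ⟩⟨ c ⟩ ψ
      ψ-cocycle = cocycle-sub-δ {φ = φ} m₁ φ-cocycle

      ψ-perm : ∀ g → IsPerm (ψ g)
      ψ-perm g = -ᶠ-perm (φ-perm g) (δ-perm g m₁-perm)

      ψ-a^t≈0 : ∀ t → ψ (a ^ t) ≈J 0ᶠ
      ψ-a^t≈0 t = begin
        φ (a ^ t) -ᶠ δ m₁ (a ^ t)       ≈⟨ -ᶠ-cong (φ≈δm₁ t) (≈J-refl {δ m₁ (a ^ t)}) ⟩
        δ m₁ (a ^ t) -ᶠ δ m₁ (a ^ t)    ≈⟨ ≗⇒≈J (λ x → ℤₚ.+-inverseʳ (δ m₁ (a ^ t) x)) ⟩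
        0ᶠ                              ∎
        where open SetoidReasoning J

      ψa≈0 : ψ a ≈J 0ᶠ
      ψa≈0 = subst (λ g → ψ g ≈J 0ᶠ) (identityʳ a) (ψ-a^t≈0 1)

      a∈⟨a⟩⟨c⟩ : ⟨ a ⟩⟨ c ⟩ a
      a∈⟨a⟩⟨c⟩ = ⟨a⟩⊆⟨a⟩⟨c⟩ a (1 , sym (identityʳ a))

      c∈⟨a⟩⟨c⟩ : ⟨ a ⟩⟨ c ⟩ c
      c∈⟨a⟩⟨c⟩ = ⟨c⟩⊆⟨a⟩⟨c⟩ c (1 , sym (identityʳ c))

      f : Fn
      f = ψ c

      act-a-f≈f : act a f ≈J f
      act-a-f≈f = begin
        act a f                ≈⟨ ≗⇒≈J (λ x → sym (ℤₚ.+-identityˡ (act a f x))) ⟩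
        0ᶠ +ᶠ act a (ψ c)      ≈⟨ +ᶠ-cong (≈J-sym ψa≈0) (≈J-refl {act a f}) ⟩
        ψ a +ᶠ act a (ψ c)     ≈⟨ ψ-cocycle a c a∈⟨a⟩⟨c⟩ c∈⟨a⟩⟨c⟩ ⟨
        ψ (a ∙ c)              ≡⟨ cong ψ ac≡ca ⟩
        ψ (c ∙ a)              ≈⟨ ψ-cocycle c a c∈⟨a⟩⟨c⟩ a∈⟨a⟩⟨c⟩ ⟩
        ψ c +ᶠ act c (ψ a)     ≈⟨ +ᶠ-cong (≈J-refl {f}) (act-cong c ψa≈0) ⟩
        ψ c +ᶠ act c 0ᶠ        ≈⟨ ≗⇒≈J (λ x → ℤₚ.+-identityʳ (f x)) ⟩
        f                      ∎
        where open SetoidReasoning J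

      f-a-fixed : ∀ x → f ((a ⁻¹) ∙ x) ≡ f x
      f-a-fixed = J-fixed⇒fixed p aᵖ≡ε act-a-f≈f

      f-constant-on-orbit : ∀ i → f (((c ^ i) ⁻¹) ∙ b) ≡ f b
      f-constant-on-orbit i = begin
        f (((c ^ i) ⁻¹) ∙ b)                ≡⟨ cong f (proj₂ (c-orbit i)) ⟩
        f (((a ^ r) ⁻¹) ∙ (b ∙ (a ^ r)))    ≡⟨ fixed-^ a f-a-fixed r (b ∙ (a ^ r)) ⟩
        f (b ∙ (a ^ r))                     ≡⟨ ψ-perm c b (a ^ r) (⟨a⟩⊆H r) ⟩
        f b                                 ∎
        where
        open ≡-Reasoning
        r = proj₁ (c-orbit i)

      open CoboundaryOnCyclic p cᵖ≡ε ψ (cocycle-mono {φ = ψ} ⟨c⟩⊆⟨a⟩⟨c⟩ ψ-cocycle) b f-constant-on-orbit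
        using () renaming (m to m₂; ψ≈δm to ψ≈δm₂; m-natural to m₂-natural)

      m₂-perm : IsPerm m₂
      m₂-perm x h h∈H = m₂-natural (λ y → sym (assoc (c ⁻¹) y h)) (λ y → ψ-perm c y h h∈H) x

      m₂-a-fixed : ∀ x → m₂ ((a ⁻¹) ∙ x) ≡ m₂ x
      m₂-a-fixed = m₂-natural c⁻¹a⁻¹≡a⁻¹c⁻¹ f-a-fixed
        where
        c⁻¹a⁻¹≡a⁻¹c⁻¹ : ∀ x → (c ⁻¹) ∙ ((a ⁻¹) ∙ x) ≡ (a ⁻¹) ∙ ((c ⁻¹) ∙ x)
        c⁻¹a⁻¹≡a⁻¹c⁻¹ x = trans (sym ([g∙h]⁻¹∙x≡h⁻¹∙[g⁻¹∙x] a c x))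
          (trans (cong (λ g → (g ⁻¹) ∙ x) ac≡ca) ([g∙h]⁻¹∙x≡h⁻¹∙[g⁻¹∙x] c a x))

      m : Fn
      m = m₁ +ᶠ m₂

      m-perm : IsPerm m
      m-perm x h h∈H = cong₂ _+_ (m₁-perm x h h∈H) (m₂-perm x h h∈H)

      φ≈δm : ∀ t s → φ ((a ^ t) ∙ (c ^ s)) ≈J δ m ((a ^ t) ∙ (c ^ s))
      φ≈δm t s = begin
        φ g                    ≈⟨ ≗⇒≈J (λ x → sym ([m-n]+n≡m (φ g x) (δ m₁ g x))) ⟩
        ψ g +ᶠ δ m₁ g          ≈⟨ +ᶠ-cong ψg≈δm₂g (≈J-refl {δ m₁ g}) ⟩
        δ m₂ g +ᶠ δ m₁ g       ≈⟨ ≗⇒≈J (λ x → ℤₚ.+-comm (δ m₂ g x) (δ m₁ g x)) ⟩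
        δ m₁ g +ᶠ δ m₂ g       ≈⟨ ≗⇒≈J (δ-+ᶠ m₁ m₂ g) ⟨
        δ m g                  ∎
        where
        open SetoidReasoning J
        g = (a ^ t) ∙ (c ^ s)
        ψg≈δm₂g : ψ g ≈J δ m₂ g
        ψg≈δm₂g = begin
          ψ g
            ≈⟨ ψ-cocycle (a ^ t) (c ^ s) (⟨a⟩⊆⟨a⟩⟨c⟩ _ (t , refl)) (⟨c⟩⊆⟨a⟩⟨c⟩ _ (s , refl)) ⟩
          ψ (a ^ t) +ᶠ act (a ^ t) (ψ (c ^ s))
            ≈⟨ +ᶠ-cong (ψ-a^t≈0 t) (act-cong (a ^ t) (ψ≈δm₂ s)) ⟩
          0ᶠ +ᶠ act (a ^ t) (δ m₂ (c ^ s))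
            ≈⟨ +ᶠ-cong (≗⇒≈J (λ x → sym (δ-fixed (a ^ t) (fixed-^ a m₂-a-fixed t) x))) ≈J-refl ⟩
          δ m₂ (a ^ t) +ᶠ act (a ^ t) (δ m₂ (c ^ s))
            ≈⟨ ≗⇒≈J (δ-cocycle m₂ (a ^ t) (c ^ s)) ⟨
          δ m₂ g ∎

    H¹-vanishes-bicyclic : H¹-vanishes ⟨ a ⟩⟨ c ⟩
    H¹-vanishes-bicyclic φ φ-perm φ-cocycle = m , m-perm , λ { _ (t , s , refl) → ≈J⇒≈Jˢ (φ≈δm t s) }
      where open VanishingOnBicyclic φ φ-perm (cocycleˢ⇒cocycle {φ = φ} φ-cocycle)
module Residues (q : ℕ) where

  open Data.Nat using (_+_; _*_; _∸_; _%_)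
  open import Data.Nat.Tactic.RingSolver using (solve-∀)

  p : ℕ
  p = suc q

  toℕ-red : ∀ n → toℕ (red p n) ≡ n % p
  toℕ-red n = toℕ-fromℕ< (m%n<n n p)

  red-cong : ∀ m n → m % p ≡ n % p → red p m ≡ red p n
  red-cong m n eq = toℕ-injective (trans (toℕ-red m) (trans eq (sym (toℕ-red n))))

  red-toℕ : ∀ x → red p (toℕ x) ≡ x
  red-toℕ x = toℕ-injective (trans (toℕ-red (toℕ x)) (m<n⇒m%n≡m (toℕ<n x)))

  red[m+k*p]≡red[m] : ∀ m k → red p (m + k * p) ≡ red p m
  red[m+k*p]≡red[m] m k = red-cong (m + k * p) m ([m+kn]%n≡m%n m k p)

  ⊕-red : ∀ m n → _⊕_ p (red p m) (red p n) ≡ red p (m + n)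
  ⊕-red m n = red-cong (toℕ (red p m) + toℕ (red p n)) (m + n) (begin
    (toℕ (red p m) + toℕ (red p n)) % p   ≡⟨ cong₂ (λ x y → (x + y) % p) (toℕ-red m) (toℕ-red n) ⟩
    (m % p + n % p) % p                   ≡⟨ %-distribˡ-+ m n p ⟨
    (m + n) % p                           ∎)
    where open ≡-Reasoning

  ⊗-red : ∀ m n → _⊗_ p (red p m) (red p n) ≡ red p (m * n)
  ⊗-red m n = red-cong (toℕ (red p m) * toℕ (red p n)) (m * n) (begin
    (toℕ (red p m) * toℕ (red p n)) % p   ≡⟨ cong₂ (λ x y → (x * y) % p) (toℕ-red m) (toℕ-red n) ⟩
    (m % p * (n % p)) % p                 ≡⟨ %-distribˡ-* m n p ⟨
    (m * n) % p                           ∎)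
    where open ≡-Reasoning

  neg-red : ∀ m → neg p (red p m) ≡ red p (q * m)
  neg-red m = begin
    red p (p ∸ r)                  ≡⟨ red[m+k*p]≡red[m] (p ∸ r) r ⟨
    red p (p ∸ r + r * p)          ≡⟨ cong (red p) p∸r+rp≡qr+p ⟩
    red p (q * r + 1 * p)          ≡⟨ red[m+k*p]≡red[m] (q * r) 1 ⟩
    red p (q * r)                  ≡⟨ ⊗-red q r ⟨
    _⊗_ p (red p q) (red p r)      ≡⟨ cong (_⊗_ p (red p q)) (red-toℕ (red p m)) ⟩
    _⊗_ p (red p q) (red p m)      ≡⟨ ⊗-red q m ⟩
    red p (q * m)                  ∎
    where
    open ≡-Reasoning
    r = toℕ (red p m)
    regroup : ∀ q r → suc q + r * q ≡ q * r + 1 * suc q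
    regroup = solve-∀
    p∸r+rp≡qr+p : p ∸ r + r * p ≡ q * r + 1 * p
    p∸r+rp≡qr+p = begin
      p ∸ r + r * p          ≡⟨ cong (_+_ (p ∸ r)) (ℕₚ.*-suc r q) ⟩
      p ∸ r + (r + r * q)    ≡⟨ ℕₚ.+-assoc (p ∸ r) r (r * q) ⟨
      p ∸ r + r + r * q      ≡⟨ cong (_+ r * q) (ℕₚ.m∸n+n≡m (ℕₚ.<⇒≤ (toℕ<n (red p m)))) ⟩
      p + r * q              ≡⟨ regroup q r ⟩
      q * r + 1 * p          ∎

module Heisenberg (q : ℕ) where

  open Data.Nat using (_+_; _*_)
  open import Data.Nat.Tactic.RingSolver using (solve-∀)
  open Residues q hiding (p)
  open Residues q public using (p)

  -- ⟪ i , j , k ⟫ is aⁱ bʲ cᵏ with exponents in ℕ: through ·-⟪⟫ and ⁻¹-⟪⟫ every identity of G p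
  -- becomes an identity of natural numbers modulo p.
  ⟪_,_,_⟫ : ℕ → ℕ → ℕ → G p
  ⟪ i , j , k ⟫ = red p i , red p j , red p k

  infixl 7 _·_
  _·_ : G p → G p → G p
  _·_ = mul p

  _⁻¹ : G p → G p
  _⁻¹ = inv p

  ·-⟪⟫ : ∀ i j k i′ j′ k′ → ⟪ i , j , k ⟫ · ⟪ i′ , j′ , k′ ⟫ ≡ ⟪ i + i′ , j + j′ , k + k′ + j * i′ ⟫
  ·-⟪⟫ i j k i′ j′ k′ = cong₂ _,_ (⊕-red i i′) (cong₂ _,_ (⊕-red j j′)
    (trans (cong₂ (_⊕_ p) (⊕-red k k′) (⊗-red j i′)) (⊕-red (k + k′) (j * i′))))

  ⁻¹-⟪⟫ : ∀ i j k → ⟪ i , j , k ⟫ ⁻¹ ≡ ⟪ q * i , q * j , q * k + j * i ⟫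
  ⁻¹-⟪⟫ i j k = cong₂ _,_ (neg-red i) (cong₂ _,_ (neg-red j)
    (trans (cong₂ (_⊕_ p) (neg-red k) (⊗-red j i)) (⊕-red (q * k) (j * i))))

  ⟪⟫-cong : ∀ {i j k i′ j′ k′} → i ≡ i′ → j ≡ j′ → k ≡ k′ → ⟪ i , j , k ⟫ ≡ ⟪ i′ , j′ , k′ ⟫
  ⟪⟫-cong i≡i′ j≡j′ k≡k′ =
    cong₂ _,_ (cong (red p) i≡i′) (cong₂ _,_ (cong (red p) j≡j′) (cong (red p) k≡k′))

  ⟪⟫-mod : ∀ i j k u v w → ⟪ i + u * p , j + v * p , k + w * p ⟫ ≡ ⟪ i , j , k ⟫
  ⟪⟫-mod i j k u v w =
    cong₂ _,_ (red[m+k*p]≡red[m] i u) (cong₂ _,_ (red[m+k*p]≡red[m] j v) (red[m+k*p]≡red[m] k w))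

  data Coordinates : G p → Set where
    coordinates : ∀ i j k → Coordinates ⟪ i , j , k ⟫

  coordinatesOf : ∀ x → Coordinates x
  coordinatesOf (i , j , k) =
    subst Coordinates (cong₂ _,_ (red-toℕ i) (cong₂ _,_ (red-toℕ j) (red-toℕ k)))
          (coordinates (toℕ i) (toℕ j) (toℕ k))

  assoc : ∀ x y z → (x · y) · z ≡ x · (y · z)
  assoc x y z with coordinatesOf x | coordinatesOf y | coordinatesOf z
  ... | coordinates i j k | coordinates i′ j′ k′ | coordinates i″ j″ k″ = begin
    (⟪ i , j , k ⟫ · ⟪ i′ , j′ , k′ ⟫) · ⟪ i″ , j″ , k″ ⟫
      ≡⟨ cong (_· ⟪ i″ , j″ , k″ ⟫) (·-⟪⟫ i j k i′ j′ k′) ⟩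
    ⟪ i + i′ , j + j′ , k + k′ + j * i′ ⟫ · ⟪ i″ , j″ , k″ ⟫
      ≡⟨ ·-⟪⟫ (i + i′) (j + j′) (k + k′ + j * i′) i″ j″ k″ ⟩
    ⟪ i + i′ + i″ , j + j′ + j″ , k + k′ + j * i′ + k″ + (j + j′) * i″ ⟫
      ≡⟨ ⟪⟫-cong (ℕₚ.+-assoc i i′ i″) (ℕₚ.+-assoc j j′ j″) (third i′ i″ j j′ k k′ k″) ⟩
    ⟪ i + (i′ + i″) , j + (j′ + j″) , k + (k′ + k″ + j′ * i″) + j * (i′ + i″) ⟫
      ≡⟨ ·-⟪⟫ i j k (i′ + i″) (j′ + j″) (k′ + k″ + j′ * i″) ⟨
    ⟪ i , j , k ⟫ · ⟪ i′ + i″ , j′ + j″ , k′ + k″ + j′ * i″ ⟫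
      ≡⟨ cong (⟪ i , j , k ⟫ ·_) (·-⟪⟫ i′ j′ k′ i″ j″ k″) ⟨
    ⟪ i , j , k ⟫ · (⟪ i′ , j′ , k′ ⟫ · ⟪ i″ , j″ , k″ ⟫) ∎
    where
    open ≡-Reasoning
    third : ∀ i′ i″ j j′ k k′ k″ →
            k + k′ + j * i′ + k″ + (j + j′) * i″ ≡ k + (k′ + k″ + j′ * i″) + j * (i′ + i″)
    third = solve-∀

  identityˡ : ∀ x → e p · x ≡ x
  identityˡ x with coordinatesOf x
  ... | coordinates i j k = trans (·-⟪⟫ 0 0 0 i j k) (⟪⟫-cong {i} {j} refl refl (ℕₚ.+-identityʳ k))

  identityʳ : ∀ x → x · e p ≡ x
  identityʳ x with coordinatesOf x
  ... | coordinates i j k =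
    trans (·-⟪⟫ i j k 0 0 0) (⟪⟫-cong (ℕₚ.+-identityʳ i) (ℕₚ.+-identityʳ j) (third j k))
    where
    third : ∀ j k → k + 0 + j * 0 ≡ k
    third = solve-∀

  inverseˡ : ∀ x → x ⁻¹ · x ≡ e p
  inverseˡ x with coordinatesOf x
  ... | coordinates i j k = begin
    ⟪ i , j , k ⟫ ⁻¹ · ⟪ i , j , k ⟫
      ≡⟨ cong (_· ⟪ i , j , k ⟫) (⁻¹-⟪⟫ i j k) ⟩
    ⟪ q * i , q * j , q * k + j * i ⟫ · ⟪ i , j , k ⟫
      ≡⟨ ·-⟪⟫ (q * i) (q * j) (q * k + j * i) i j k ⟩
    ⟪ q * i + i , q * j + j , q * k + j * i + k + q * j * i ⟫
      ≡⟨ ⟪⟫-cong (first q i) (first q j) (third q i j k) ⟩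
    ⟪ 0 + i * p , 0 + j * p , 0 + (k + j * i) * p ⟫
      ≡⟨ ⟪⟫-mod 0 0 0 i j (k + j * i) ⟩
    e p ∎
    where
    open ≡-Reasoning
    first : ∀ q i → q * i + i ≡ i * suc q
    first = solve-∀
    third : ∀ q i j k → q * k + j * i + k + q * j * i ≡ (k + j * i) * suc q
    third = solve-∀

  inverseʳ : ∀ x → x · x ⁻¹ ≡ e p
  inverseʳ x with coordinatesOf x
  ... | coordinates i j k = begin
    ⟪ i , j , k ⟫ · ⟪ i , j , k ⟫ ⁻¹
      ≡⟨ cong (⟪ i , j , k ⟫ ·_) (⁻¹-⟪⟫ i j k) ⟩
    ⟪ i , j , k ⟫ · ⟪ q * i , q * j , q * k + j * i ⟫
      ≡⟨ ·-⟪⟫ i j k (q * i) (q * j) (q * k + j * i) ⟩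
    ⟪ i + q * i , j + q * j , k + (q * k + j * i) + j * (q * i) ⟫
      ≡⟨ ⟪⟫-cong (first q i) (first q j) (third q i j k) ⟩
    ⟪ 0 + i * p , 0 + j * p , 0 + (k + j * i) * p ⟫
      ≡⟨ ⟪⟫-mod 0 0 0 i j (k + j * i) ⟩
    e p ∎
    where
    open ≡-Reasoning
    first : ∀ q i → i + q * i ≡ i * suc q
    first = solve-∀
    third : ∀ q i j k → k + (q * k + j * i) + j * (q * i) ≡ (k + j * i) * suc q
    third = solve-∀

  isGroup : IsGroup _≡_ _·_ (e p) _⁻¹
  isGroup = record
    { isMonoid = record
      { isSemigroup = record
        { isMagma = record { isEquivalence = isEquivalence ; ∙-cong = cong₂ _·_ }
        ; assoc   = assoc
        }
      ; identity = identityˡ , identityʳ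
      }
    ; inverse = inverseˡ , inverseʳ
    ; ⁻¹-cong = cong _⁻¹
    }

  open Cohomology isGroup (InH p) public

  a b c : G p
  a = gen-a p
  b = gen-b p
  c = gen-c p

  aᵗ≡⟪t,0,0⟫ : ∀ t → a ^ t ≡ ⟪ t , 0 , 0 ⟫
  aᵗ≡⟪t,0,0⟫ zero    = refl
  aᵗ≡⟪t,0,0⟫ (suc t) = trans (cong (a ·_) (aᵗ≡⟪t,0,0⟫ t)) (·-⟪⟫ 1 0 0 t 0 0)

  cˢ≡⟪0,0,s⟫ : ∀ s → c ^ s ≡ ⟪ 0 , 0 , s ⟫
  cˢ≡⟪0,0,s⟫ zero    = refl
  cˢ≡⟪0,0,s⟫ (suc s) = trans (cong (c ·_) (cˢ≡⟪0,0,s⟫ s))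
    (trans (·-⟪⟫ 0 0 1 0 0 s) (⟪⟫-cong {0} {0} refl refl (ℕₚ.+-identityʳ (suc s))))

  aᵖ≡e : a ^ p ≡ e p
  aᵖ≡e = trans (aᵗ≡⟪t,0,0⟫ p)
    (trans (⟪⟫-cong {j = 0} {k = 0} (sym (ℕₚ.+-identityʳ p)) refl refl) (⟪⟫-mod 0 0 0 1 0 0))

  cᵖ≡e : c ^ p ≡ e p
  cᵖ≡e = trans (cˢ≡⟪0,0,s⟫ p)
    (trans (⟪⟫-cong {0} {0} refl refl (sym (ℕₚ.+-identityʳ p))) (⟪⟫-mod 0 0 0 0 0 1))

  ac≡ca : a · c ≡ c · a
  ac≡ca = trans (·-⟪⟫ 1 0 0 0 0 1) (sym (·-⟪⟫ 0 0 1 1 0 0))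

  -- With r = q i, aʳ = a⁻ⁱ, so this is c⁻ⁱ b = aⁱ b a⁻ⁱ.
  c-orbit : ∀ i → Σ ℕ λ r → (c ^ i) ⁻¹ · b ≡ (a ^ r) ⁻¹ · (b · a ^ r)
  c-orbit i = r , trans c⁻ⁱb≡⟪0,1,r⟫ (sym a⁻ʳbaʳ≡⟪0,1,r⟫)
    where
    open ≡-Reasoning
    r = q * i
    q*0+n : ∀ q n → q * 0 + n ≡ n
    q*0+n = solve-∀
    c⁻ⁱb≡⟪0,1,r⟫ : (c ^ i) ⁻¹ · b ≡ ⟪ 0 , 1 , r ⟫
    c⁻ⁱb≡⟪0,1,r⟫ = begin
      (c ^ i) ⁻¹ · b
        ≡⟨ cong (λ x → x ⁻¹ · b) (cˢ≡⟪0,0,s⟫ i) ⟩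
      ⟪ 0 , 0 , i ⟫ ⁻¹ · ⟪ 0 , 1 , 0 ⟫
        ≡⟨ cong (_· b) (⁻¹-⟪⟫ 0 0 i) ⟩
      ⟪ q * 0 , q * 0 , q * i + 0 * 0 ⟫ · ⟪ 0 , 1 , 0 ⟫
        ≡⟨ ·-⟪⟫ (q * 0) (q * 0) (q * i + 0 * 0) 0 1 0 ⟩
      ⟪ q * 0 + 0 , q * 0 + 1 , q * i + 0 * 0 + 0 + q * 0 * 0 ⟫
        ≡⟨ ⟪⟫-cong (q*0+n q 0) (q*0+n q 1) (third q i) ⟩
      ⟪ 0 , 1 , r ⟫ ∎
      where
      third : ∀ q i → q * i + 0 * 0 + 0 + q * 0 * 0 ≡ q * i
      third = solve-∀
    a⁻ʳbaʳ≡⟪0,1,r⟫ : (a ^ r) ⁻¹ · (b · a ^ r) ≡ ⟪ 0 , 1 , r ⟫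
    a⁻ʳbaʳ≡⟪0,1,r⟫ = begin
      (a ^ r) ⁻¹ · (b · a ^ r)
        ≡⟨ cong (λ x → x ⁻¹ · (b · x)) (aᵗ≡⟪t,0,0⟫ r) ⟩
      ⟪ r , 0 , 0 ⟫ ⁻¹ · (⟪ 0 , 1 , 0 ⟫ · ⟪ r , 0 , 0 ⟫)
        ≡⟨ cong₂ _·_ (⁻¹-⟪⟫ r 0 0) (·-⟪⟫ 0 1 0 r 0 0) ⟩
      ⟪ q * r , q * 0 , q * 0 + 0 * r ⟫ · ⟪ r , 1 , 1 * r ⟫
        ≡⟨ ·-⟪⟫ (q * r) (q * 0) (q * 0 + 0 * r) r 1 (1 * r) ⟩
      ⟪ q * r + r , q * 0 + 1 , q * 0 + 0 * r + 1 * r + q * 0 * r ⟫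
        ≡⟨ ⟪⟫-cong (first q r) (q*0+n q 1) (third q r) ⟩
      ⟪ 0 + r * p , 1 + 0 * p , r + 0 * p ⟫
        ≡⟨ ⟪⟫-mod 0 1 r r 0 0 ⟩
      ⟪ 0 , 1 , r ⟫ ∎
      where
      first : ∀ q r → q * r + r ≡ r * suc q
      first = solve-∀
      third : ∀ q r → q * 0 + 0 * r + 1 * r + q * 0 * r ≡ r + 0
      third = solve-∀

  pow≡^ : ∀ g t → pow p g t ≡ g ^ t
  pow≡^ g zero    = refl
  pow≡^ g (suc t) = cong (g ·_) (pow≡^ g t)

  aᵗ∈H : ∀ t → InH p (a ^ t)
  aᵗ∈H t = t , sym (pow≡^ a t)

  H⊆⟨a⟩ : ∀ g → InH p g → ⟨ a ⟩ g
  H⊆⟨a⟩ g (t , g≡aᵗ) = t , trans g≡aᵗ (pow≡^ a t)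

  ⟨a⟩⊆H : ∀ g → ⟨ a ⟩ g → InH p g
  ⟨a⟩⊆H g (t , g≡aᵗ) = t , trans g≡aᵗ (sym (pow≡^ a t))

  H′₀⊆⟨a⟩⟨c⟩ : ∀ g → InH'0 p g → ⟨ a ⟩⟨ c ⟩ g
  H′₀⊆⟨a⟩⟨c⟩ g (t , s , g≡aᵗcˢ) = t , s , trans g≡aᵗcˢ (cong₂ _·_ (pow≡^ a t) (pow≡^ c s))

  ⟨a⟩⟨c⟩⊆H′₀ : ∀ g → ⟨ a ⟩⟨ c ⟩ g → InH'0 p g
  ⟨a⟩⟨c⟩⊆H′₀ g (t , s , g≡aᵗcˢ) = t , s , trans g≡aᵗcˢ (sym (cong₂ _·_ (pow≡^ a t) (pow≡^ c s)))

open Data.Nat using (_≤_)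

lemma2p10 : (p : ℕ) .{{_ : NonZero p}} → Prime p → 3 ≤ p →
    H1J-vanishes p (InH p) × H1J-vanishes p (InH'0 p)
lemma2p10 (suc q) _ _ =
    H¹-vanishes-resp H⊆⟨a⟩ ⟨a⟩⊆H (H¹-vanishes-cyclic p aᵖ≡e aᵗ∈H)
  , H¹-vanishes-resp H′₀⊆⟨a⟩⟨c⟩ ⟨a⟩⟨c⟩⊆H′₀ (H¹-vanishes-bicyclic p aᵖ≡e cᵖ≡e aᵗ∈H ac≡ca c-orbit)
  where open Heisenberg q
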